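{- Let $p$ be a prime, let $\alpha_{ -1},\alpha_0,\alpha_1\in\mathbb{Z}$, $P(x)=\alpha_{ -1}x^{ -1}+\alpha_0+\alpha_1x$, and $a_n=ct\left[P(x)^n\right]$. Suppose $p$ divides $a_n$ for some $n\ge 0$. Let $h\ge 0$, $c_0,\ldots,c_h\in\mathbb{Z}$ and $b_n=\sum_{i=0}^h c_ia_{n+i}$. Then the set $\{n\ge 0: b_n\equiv 0\pmod p\}$ has density $1$.
   Context: $ct[R(x)]$ denotes the constant term of a Laurent polynomial $R(x)$ with integer coefficients. A set $S\subseteq\mathbb{Z}_{\ge 0}$ has density $1$ if $|S\cap\{0,\ldots,N-1\}|/N\to 1$ as $N\to\infty$. -}

module Defs where

open import Data.Nat as ℕ using (ℕ; zero; suc)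
open import Data.Integer as ℤ using (ℤ; +_; -[1+_])
open import Data.Integer.Divisibility.Signed using (_∣_; _∣?_)
open import Relation.Nullary using (Dec; yes; no)
open import Relation.Nullary.Decidable using (⌊_⌋)
open import Data.Bool using (if_then_else_)

-- The Laurent polynomial P(x) = α₋₁ x⁻¹ + α₀ + α₁ x is given by its
-- three coefficients.  coeffPow α₋₁ α₀ α₁ n k is the coefficient of x^k
-- in P(x)^n, computed by the literal product rule for P^(n+1) = P^n · P.
coeffPow : ℤ → ℤ → ℤ → ℕ → ℤ → ℤ
coeffPow αm α0 α1 zero    k = if ⌊ k ℤ.≟ + 0 ⌋ then + 1 else + 0
coeffPow αm α0 α1 (suc n) k =
  αm ℤ.* coeffPow αm α0 α1 n (k ℤ.+ + 1)
  ℤ.+ α0 ℤ.* coeffPow αm α0 α1 n k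
  ℤ.+ α1 ℤ.* coeffPow αm α0 α1 n (k ℤ.- + 1)

ctPow : ℤ → ℤ → ℤ → ℕ → ℤ
ctPow αm α0 α1 n = coeffPow αm α0 α1 n (+ 0)

sumTo : ℕ → (ℕ → ℤ) → ℤ
sumTo zero    f = f 0
sumTo (suc h) f = sumTo h f ℤ.+ f (suc h)

countDiv : ℤ → (ℕ → ℤ) → ℕ → ℕ
countDiv d f zero    = 0
countDiv d f (suc N) with d ∣? f N
... | yes _ = suc (countDiv d f N)
... | no  _ = countDiv d f N

-- {n : d ∣ f n} has density 1: |S ∩ [0,N)|/N → 1. Since the ratio is ≤ 1,
-- this means: for every k ≥ 1 there is N₀ with ratio ≥ 1 - 1/k for N ≥ N₀.
DivDensityOne : ℤ → (ℕ → ℤ) → Set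
DivDensityOne d f =
  (k : ℕ) → 1 ℕ.≤ k →
  Σ′ ℕ (λ N₀ → (N : ℕ) → N₀ ℕ.≤ N → (k ℕ.∸ 1) ℕ.* N ℕ.≤ k ℕ.* countDiv d f N)
  where
  open import Data.Product using () renaming (Σ to Σ′)

-- Modulo p, multiplication by P(x) acts on coefficient sequences as a sum of three commuting
-- scaled shifts, so the freshman's dream and Fermat's little theorem give P(x)^p ≡ P(x^p).
-- Hence P(x)^(r+mp) ≡ P(x)^r · P(x^p)^m, and for r < p only the constant term of P(x^p)^m
-- meets the constant term: a_(r+mp) ≡ a_r · a_m (mod p).  So p ∣ a_n yields a digit d < p
-- with p ∣ a_d, and then p ∣ a_n for every n whose base-p expansion contains the digit d.
-- Group the base-p digits into blocks of base B = p^(h+3) and call a block good when adding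
-- any i ≤ h to it still leaves d among its digits; if one of the J lowest blocks of n is
-- good then p ∣ a_(n+i) for all i ≤ h, hence p ∣ b_n.  Below Q·B^J only u^J·Q numbers have
-- no good block among their J lowest ones, where u < B counts the bad blocks, and
-- (u/B)^J → 0 by Bernoulli's inequality.

module Submission where

open import Defs
open import Data.Nat using (ℕ)
open import Data.Nat.Primality using (Prime)
open import Data.Integer using (ℤ)
import Algebra.Bundles
import Data.Bool.Base
import Data.Nat.Base

module PrimeDivisibility where

  open import Data.Integer.Base using (+_; ∣_∣; _*_)
  import Data.Integer.Properties as ℤ
  open import Data.Integer.Divisibility.Signed using (∣⇒∣ᵤ; ∣ᵤ⇒∣) renaming (_∣_ to _∣ℤ_)
  open import Data.Nat.Base using (zero; suc; _!; _<_; _≤_; _∸_; NonZero; nonTrivial⇒nonZero; nonTrivial⇒n>1)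
    renaming (_*_ to _*ℕ_)
  open import Data.Nat.Combinatorics using (_C_; nCk≡n!/k![n-k]!; k![n∸k]!∣n!)
  open import Data.Nat.Divisibility using (_∣_; _∤_; ∣⇒≤; m∣m*n)
  open import Data.Nat.DivMod using (m*[n/m]≡n)
  open import Data.Nat.Properties using (<⇒≱; <⇒≤; <-trans; n<1+n; ∸-monoʳ-<; _!*_!≢0)
  open import Data.Nat.Primality using (euclidsLemma)
  open import Data.Sum using (_⊎_; inj₁; inj₂; map)
  open import Relation.Nullary using (contradiction)
  open import Relation.Binary.PropositionalEquality using (_≡_; subst; sym)

  k![n∸k]!*nCk≡n! : ∀ {n k} → k ≤ n → k ! *ℕ (n ∸ k) ! *ℕ (n C k) ≡ n !
  k![n∸k]!*nCk≡n! {n} {k} k≤n =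
    subst (λ c → k ! *ℕ (n ∸ k) ! *ℕ c ≡ n !) (sym (nCk≡n!/k![n-k]! k≤n))
      (m*[n/m]≡n {{k !* (n ∸ k) !≢0}} (k![n∸k]!∣n! k≤n))

  n∣n! : ∀ n → .{{NonZero n}} → n ∣ n !
  n∣n! (suc n) = m∣m*n (n !)

  module _ {p : ℕ} (p-prime : Prime p) where

    open Prime p-prime using (nontrivial)
    instance _ = nonTrivial⇒nonZero p

    prime∤factorial : ∀ {m} → m < p → p ∤ m !
    prime∤factorial {zero}  _   p∣1 = <⇒≱ (nonTrivial⇒n>1 p) (∣⇒≤ p∣1)
    prime∤factorial {suc m} m<p p∣m! with euclidsLemma (suc m) (m !) p-prime p∣m!
    ... | inj₁ p∣1+m = <⇒≱ m<p (∣⇒≤ p∣1+m)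
    ... | inj₂ p∣m!  = prime∤factorial (<-trans (n<1+n m) m<p) p∣m!

    prime∣binomial : ∀ {k} → 0 < k → k < p → p ∣ p C k
    prime∣binomial {k} 0<k k<p
      with euclidsLemma (k ! *ℕ (p ∸ k) !) (p C k) p-prime
             (subst (p ∣_) (sym (k![n∸k]!*nCk≡n! (<⇒≤ k<p))) (n∣n! p))
    ... | inj₂ p∣pCk = p∣pCk
    ... | inj₁ p∣k![p-k]! with euclidsLemma (k !) ((p ∸ k) !) p-prime p∣k![p-k]!
    ...   | inj₁ p∣k!     = contradiction p∣k! (prime∤factorial k<p)
    ...   | inj₂ p∣[p-k]! = contradiction p∣[p-k]! (prime∤factorial (∸-monoʳ-< 0<k (<⇒≤ k<p)))

    euclidsLemmaℤ : ∀ x y → + p ∣ℤ x * y → (+ p ∣ℤ x) ⊎ (+ p ∣ℤ y)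
    euclidsLemmaℤ x y p∣xy =
      map ∣ᵤ⇒∣ ∣ᵤ⇒∣ (euclidsLemma ∣ x ∣ ∣ y ∣ p-prime (subst (p ∣_) (ℤ.abs-* x y) (∣⇒∣ᵤ p∣xy)))

module FreshmansDream {c ℓ} (S : Algebra.Bundles.Semiring c ℓ) where

  open Algebra.Bundles.Semiring S hiding (zero)
  open import Algebra.Definitions.RawSemiring rawSemiring using (_^_; _×_; sum)
  open import Algebra.Properties.Semiring.Mult S using (×-assoc-*; ×1-homo-*; ×-congʳ; ×-congˡ)
  open import Algebra.Properties.Semiring.Sum S using (sum-init-last; sum-cong-≋; sum-replicate-zero)
  open import Data.Fin.Base using (zero; suc; inject₁; fromℕ)
  open import Data.Fin.Properties using (toℕ-fromℕ; inject₁ℕ<)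
  open import Data.Nat.Base as ℕ using ()
  open import Data.Nat.Combinatorics using (nCn≡1)
  open import Data.Nat.Divisibility using (divides)
  open import Data.Nat.Primality using (¬prime[0]; ¬prime[1])
  open import Data.Nat.Properties using (n∸n≡0)
  open import Data.Vec.Functional using (Vector)
  open import Relation.Nullary using (contradiction)
  open import Relation.Binary.Reasoning.Setoid setoid
  open PrimeDivisibility using (prime∣binomial)

  sum≈head+last : ∀ {n} (t : Vector Carrier (ℕ.suc (ℕ.suc n))) →
                  (∀ i → t (suc (inject₁ i)) ≈ 0#) → sum t ≈ t zero + t (fromℕ (ℕ.suc n))
  sum≈head+last {n} t inner≈0 = begin
    t zero + sum (λ i → t (suc i))                                    ≈⟨ +-congˡ (sum-init-last (λ i → t (suc i))) ⟩
    t zero + (sum (λ i → t (suc (inject₁ i))) + t (fromℕ (ℕ.suc n)))  ≈⟨ +-congˡ (+-congʳ inner-sum≈0) ⟩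
    t zero + (0# + t (fromℕ (ℕ.suc n)))                               ≈⟨ +-congˡ (+-identityˡ _) ⟩
    t zero + t (fromℕ (ℕ.suc n))                                      ∎
    where
    inner-sum≈0 : sum (λ i → t (suc (inject₁ i))) ≈ 0#
    inner-sum≈0 = trans (sum-cong-≋ inner≈0) (sum-replicate-zero n)

  multiple×≈0 : ∀ {p} → p × 1# ≈ 0# → ∀ m x → (m ℕ.* p) × x ≈ 0#
  multiple×≈0 {p} p×1≈0 m x = begin
    (m ℕ.* p) × x                ≈⟨ ×-congʳ (m ℕ.* p) (*-identityˡ x) ⟨
    (m ℕ.* p) × (1# * x)         ≈⟨ ×-assoc-* (m ℕ.* p) 1# x ⟨
    ((m ℕ.* p) × 1#) * x         ≈⟨ *-congʳ (×1-homo-* m p) ⟩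
    ((m × 1#) * (p × 1#)) * x    ≈⟨ *-congʳ (*-congˡ p×1≈0) ⟩
    ((m × 1#) * 0#) * x          ≈⟨ *-congʳ (zeroʳ _) ⟩
    0# * x                       ≈⟨ zeroˡ x ⟩
    0#                           ∎

  module _ {x y : Carrier} where

    open import Algebra.Properties.Semiring.Binomial S x y using (theorem; binomialTerm)

    binomialTerm-last : ∀ n → binomialTerm n (fromℕ n) ≈ x ^ n
    binomialTerm-last n rewrite toℕ-fromℕ n | nCn≡1 n | n∸n≡0 n = trans (+-identityʳ _) (*-identityʳ _)

    freshmansDream : ∀ {p} → Prime p → p × 1# ≈ 0# → x * y ≈ y * x → (x + y) ^ p ≈ x ^ p + y ^ p
    freshmansDream {0} p-prime = contradiction p-prime ¬prime[0]
    freshmansDream {1} p-prime = contradiction p-prime ¬prime[1]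
    freshmansDream {p@(ℕ.suc (ℕ.suc _))} p-prime p×1≈0 xy≈yx = begin
      (x + y) ^ p                                     ≈⟨ theorem xy≈yx p ⟩
      sum (binomialTerm p)                            ≈⟨ sum≈head+last (binomialTerm p) inner≈0 ⟩
      binomialTerm p zero + binomialTerm p (fromℕ p)
        ≈⟨ +-cong (trans (+-identityʳ _) (*-identityˡ _)) (binomialTerm-last p) ⟩
      y ^ p + x ^ p                                   ≈⟨ +-comm _ _ ⟩
      x ^ p + y ^ p                                   ∎
      where
      inner≈0 : ∀ i → binomialTerm p (suc (inject₁ i)) ≈ 0#
      inner≈0 i with prime∣binomial p-prime ℕ.z<s (ℕ.s<s (inject₁ℕ< i))
      ... | divides m pCi≡m*p = trans (×-congˡ pCi≡m*p) (multiple×≈0 p×1≈0 m _)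

module Modulo (n : ℕ) where

  open import Algebra.Bundles using (CommutativeRing)
  open import Algebra.Structures using (IsCommutativeRing)
  open import Data.Integer.Base using (+_; _+_; _*_; _-_; -_; 0ℤ; 1ℤ)
  import Data.Integer.Properties as ℤ
  open import Data.Integer.Divisibility.Signed
    using (_∣_; _∣?_; divides; ∣m∣n⇒∣m+n; ∣m⇒∣-m; ∣n⇒∣m*n; ∣m⇒∣m*n; ∣-refl)
  open import Data.Integer.Tactic.RingSolver using (solve-∀)
  open import Data.Product using (_,_)
  open import Level using (0ℓ)
  open import Relation.Binary.PropositionalEquality as ≡ using (_≡_; subst)
  open import Relation.Binary.Structures using (IsEquivalence)
  open import Relation.Nullary.Decidable using (recompute)

  -- The witness is irrelevant (congruence is a proposition), so that endomorphisms, whose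
  -- fields are congruence proofs, are compared without unfolding those proofs.
  infix 4 _≈_
  record _≈_ (a b : ℤ) : Set where
    constructor ∣-difference
    field .n∣a-b : + n ∣ a - b

  private
    via : ∀ {a b c} → a - b ≡ c → .(+ n ∣ c) → a ≈ b
    via a-b≡c n∣c = ∣-difference (subst (+ n ∣_) (≡.sym a-b≡c) n∣c)

  ≈-reflexive : ∀ {a b} → a ≡ b → a ≈ b
  ≈-reflexive {a} ≡.refl = via (ℤ.+-inverseʳ a) (divides 0ℤ ≡.refl)

  ∣⇒≈0 : ∀ {a} → + n ∣ a → a ≈ 0ℤ
  ∣⇒≈0 {a} n∣a = via (ℤ.+-identityʳ a) n∣a

  ≈0⇒∣ : ∀ {a} → a ≈ 0ℤ → + n ∣ a
  ≈0⇒∣ {a} (∣-difference n∣a-0) = recompute (+ n ∣? a) (subst (+ n ∣_) (ℤ.+-identityʳ a) n∣a-0)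

  n*≈0 : ∀ a → + n * a ≈ 0ℤ
  n*≈0 a = ∣⇒≈0 (∣m⇒∣m*n a ∣-refl)

  ≈-isEquivalence : IsEquivalence _≈_
  ≈-isEquivalence = record
    { refl  = ≈-reflexive ≡.refl
    ; sym   = λ { {a} {b} (∣-difference n∣a-b) → via (b-a≡-[a-b] a b) (∣m⇒∣-m n∣a-b) }
    ; trans = λ { {a} {b} {c} (∣-difference n∣a-b) (∣-difference n∣b-c) →
                  via (a-c≡[a-b]+[b-c] a b c) (∣m∣n⇒∣m+n n∣a-b n∣b-c) } }
    where
    b-a≡-[a-b] : ∀ a b → b - a ≡ - (a - b)
    b-a≡-[a-b] = solve-∀
    a-c≡[a-b]+[b-c] : ∀ a b c → a - c ≡ (a - b) + (b - c)
    a-c≡[a-b]+[b-c] = solve-∀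

  open IsEquivalence ≈-isEquivalence public using () renaming (refl to ≈-refl; sym to ≈-sym; trans to ≈-trans)

  +-cong : ∀ {a b c d} → a ≈ b → c ≈ d → a + c ≈ b + d
  +-cong {a} {b} {c} {d} (∣-difference n∣a-b) (∣-difference n∣c-d) =
    via ([a+c]-[b+d]≡[a-b]+[c-d] a b c d) (∣m∣n⇒∣m+n n∣a-b n∣c-d)
    where
    [a+c]-[b+d]≡[a-b]+[c-d] : ∀ a b c d → (a + c) - (b + d) ≡ (a - b) + (c - d)
    [a+c]-[b+d]≡[a-b]+[c-d] = solve-∀

  *-cong : ∀ {a b c d} → a ≈ b → c ≈ d → a * c ≈ b * d
  *-cong {a} {b} {c} {d} (∣-difference n∣a-b) (∣-difference n∣c-d) =
    via (ac-bd≡[a-b]c+b[c-d] a b c d) (∣m∣n⇒∣m+n (∣m⇒∣m*n c n∣a-b) (∣n⇒∣m*n b n∣c-d))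
    where
    ac-bd≡[a-b]c+b[c-d] : ∀ a b c d → a * c - b * d ≡ (a - b) * c + b * (c - d)
    ac-bd≡[a-b]c+b[c-d] = solve-∀

  -‿cong : ∀ {a b} → a ≈ b → - a ≈ - b
  -‿cong {a} {b} (∣-difference n∣a-b) = via (-a--b≡-[a-b] a b) (∣m⇒∣-m n∣a-b)
    where
    -a--b≡-[a-b] : ∀ a b → - a - - b ≡ - (a - b)
    -a--b≡-[a-b] = solve-∀

  isCommutativeRing : IsCommutativeRing _≈_ _+_ _*_ -_ 0ℤ 1ℤ
  isCommutativeRing = record
    { isRing = record
      { +-isAbelianGroup = record
        { isGroup = record
          { isMonoid = record
            { isSemigroup = record
              { isMagma = record { isEquivalence = ≈-isEquivalence ; ∙-cong = +-cong }
              ; assoc = λ a b c → ≈-reflexive (ℤ.+-assoc a b c) }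
            ; identity = (λ a → ≈-reflexive (ℤ.+-identityˡ a)) , (λ a → ≈-reflexive (ℤ.+-identityʳ a)) }
          ; inverse = (λ a → ≈-reflexive (ℤ.+-inverseˡ a)) , (λ a → ≈-reflexive (ℤ.+-inverseʳ a))
          ; ⁻¹-cong = -‿cong }
        ; comm = λ a b → ≈-reflexive (ℤ.+-comm a b) }
      ; *-cong = *-cong
      ; *-assoc = λ a b c → ≈-reflexive (ℤ.*-assoc a b c)
      ; *-identity = (λ a → ≈-reflexive (ℤ.*-identityˡ a)) , (λ a → ≈-reflexive (ℤ.*-identityʳ a))
      ; distrib = (λ a b c → ≈-reflexive (ℤ.*-distribˡ-+ a b c)) , (λ a b c → ≈-reflexive (ℤ.*-distribʳ-+ a b c)) }
    ; *-comm = λ a b → ≈-reflexive (ℤ.*-comm a b) }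

  commutativeRing : CommutativeRing 0ℓ 0ℓ
  commutativeRing = record { isCommutativeRing = isCommutativeRing }

module FermatsLittleTheorem {p : ℕ} (p-prime : Prime p) where

  open import Algebra.Bundles using (CommutativeRing; Semiring)
  open import Data.Integer.Base using (+_; -[1+_]; _+_; _*_; _^_; 0ℤ; 1ℤ; -1ℤ)
  import Data.Integer.Properties as ℤ
  open import Data.Integer.Divisibility.Signed using (∣-refl)
  open import Data.Nat.Base as ℕ using (suc)
  open import Relation.Binary.PropositionalEquality as ≡ using (_≡_)

  open Modulo p
  open CommutativeRing commutativeRing using (semiring; ring; +-congˡ; setoid)
  open import Algebra.Definitions.RawSemiring (Semiring.rawSemiring semiring)
    using (_×_) renaming (_^_ to _^ₛ_)
  open import Algebra.Properties.Ring ring using (+-cancelˡ)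
  open FreshmansDream semiring using (freshmansDream)
  open import Relation.Binary.Reasoning.Setoid setoid

  open Prime p-prime using (nontrivial)
  instance _ = ℕ.nonTrivial⇒nonZero p

  characteristic : p × 1ℤ ≈ 0ℤ
  characteristic = ≈-trans (≈-reflexive (×1≡+ p)) (∣⇒≈0 ∣-refl)
    where
    ×1≡+ : ∀ m → m × 1ℤ ≡ + m
    ×1≡+ ℕ.zero  = ≡.refl
    ×1≡+ (suc m) = ≡.cong (_+_ 1ℤ) (×1≡+ m)

  frobenius-1+ : ∀ a → (1ℤ + a) ^ p ≈ 1ℤ + a ^ p
  frobenius-1+ a = begin
    (1ℤ + a) ^ p       ≡⟨ ^ₛ≡^ (1ℤ + a) p ⟨
    (1ℤ + a) ^ₛ p      ≈⟨ freshmansDream p-prime characteristic (≈-reflexive (ℤ.*-comm 1ℤ a)) ⟩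
    1ℤ ^ₛ p + a ^ₛ p   ≡⟨ ≡.cong₂ _+_ (≡.trans (^ₛ≡^ 1ℤ p) (ℤ.^-zeroˡ p)) (^ₛ≡^ a p) ⟩
    1ℤ + a ^ p         ∎
    where
    ^ₛ≡^ : ∀ a n → a ^ₛ n ≡ a ^ n
    ^ₛ≡^ a ℕ.zero  = ≡.refl
    ^ₛ≡^ a (suc n) = ≡.cong (a *_) (^ₛ≡^ a n)

  fermat-pred : ∀ a → (1ℤ + a) ^ p ≈ 1ℤ + a → a ^ p ≈ a
  fermat-pred a fermat[1+a] = +-cancelˡ 1ℤ _ _ (begin
    1ℤ + a ^ p       ≈⟨ frobenius-1+ a ⟨
    (1ℤ + a) ^ p     ≈⟨ fermat[1+a] ⟩
    1ℤ + a           ∎)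

  fermat : ∀ a → a ^ p ≈ a
  fermat (+ ℕ.zero)    = 0^p≈0 p
    where
    0^p≈0 : ∀ n → .{{ℕ.NonZero n}} → 0ℤ ^ n ≈ 0ℤ
    0^p≈0 (suc n) = ≈-refl
  fermat (+ suc n)     = begin
    (1ℤ + + n) ^ p   ≈⟨ frobenius-1+ (+ n) ⟩
    1ℤ + (+ n) ^ p   ≈⟨ +-congˡ {1ℤ} (fermat (+ n)) ⟩
    1ℤ + + n         ∎
  fermat -[1+ ℕ.zero ] = fermat-pred -1ℤ (fermat 0ℤ)
  fermat -[1+ suc n ]  = fermat-pred -[1+ suc n ] (fermat -[1+ n ])

module EndomorphismSemiring {c ℓ} (M : Algebra.Bundles.CommutativeMonoid c ℓ) where

  open Algebra.Bundles.CommutativeMonoid M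
  open import Algebra.Bundles using (Semiring)
  open import Algebra.Morphism.Bundles using (MonoidHomomorphism)
  open import Algebra.Properties.CommutativeSemigroup commutativeSemigroup using (interchange)
  open import Algebra.Structures.Biased using (isSemiringWithoutAnnihilatingZero*)
  open import Data.Product using (_,_)
  open import Function.Base using (id; _∘_)
  open import Level using (_⊔_)
  open import Relation.Binary.Structures using (IsEquivalence)
  open import Relation.Binary.Bundles using (Setoid)
  open import Relation.Binary.Reasoning.Setoid setoid

  Endomorphism : Set (c ⊔ ℓ)
  Endomorphism = MonoidHomomorphism rawMonoid rawMonoid

  open MonoidHomomorphism public using (⟦_⟧; ⟦⟧-cong; homo; ε-homo)

  endomorphism : (f : Carrier → Carrier) → (∀ {x y} → x ≈ y → f x ≈ f y) →
                 (∀ x y → f (x ∙ y) ≈ f x ∙ f y) → f ε ≈ ε → Endomorphism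
  endomorphism f f-cong f-homo f-ε = record
    { ⟦_⟧ = f
    ; isMonoidHomomorphism = record
      { isMagmaHomomorphism = record
        { isRelHomomorphism = record { cong = f-cong }
        ; homo = f-homo }
      ; ε-homo = f-ε } }

  infix  4 _≈ᴱ_
  infixl 6 _+ᴱ_
  infixl 7 _*ᴱ_

  record _≈ᴱ_ (F G : Endomorphism) : Set (c ⊔ ℓ) where
    constructor pointwise
    field at : ∀ x → ⟦ F ⟧ x ≈ ⟦ G ⟧ x

  open _≈ᴱ_ public

  _+ᴱ_ : Endomorphism → Endomorphism → Endomorphism
  F +ᴱ G = endomorphism (λ x → ⟦ F ⟧ x ∙ ⟦ G ⟧ x)
    (λ x≈y → ∙-cong (⟦⟧-cong F x≈y) (⟦⟧-cong G x≈y))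
    (λ x y → begin
      ⟦ F ⟧ (x ∙ y) ∙ ⟦ G ⟧ (x ∙ y)                   ≈⟨ ∙-cong (homo F x y) (homo G x y) ⟩
      (⟦ F ⟧ x ∙ ⟦ F ⟧ y) ∙ (⟦ G ⟧ x ∙ ⟦ G ⟧ y)       ≈⟨ interchange _ _ _ _ ⟩
      (⟦ F ⟧ x ∙ ⟦ G ⟧ x) ∙ (⟦ F ⟧ y ∙ ⟦ G ⟧ y)       ∎)
    (trans (∙-cong (ε-homo F) (ε-homo G)) (identityˡ ε))

  _*ᴱ_ : Endomorphism → Endomorphism → Endomorphism
  F *ᴱ G = endomorphism (⟦ F ⟧ ∘ ⟦ G ⟧)
    (⟦⟧-cong F ∘ ⟦⟧-cong G)
    (λ x y → trans (⟦⟧-cong F (homo G x y)) (homo F _ _))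
    (trans (⟦⟧-cong F (ε-homo G)) (ε-homo F))

  0ᴱ : Endomorphism
  0ᴱ = endomorphism (λ _ → ε) (λ _ → refl) (λ _ _ → sym (identityˡ ε)) refl

  1ᴱ : Endomorphism
  1ᴱ = endomorphism id id (λ _ _ → refl) refl

  ≈ᴱ-isEquivalence : IsEquivalence _≈ᴱ_
  ≈ᴱ-isEquivalence = record
    { refl  = pointwise λ _ → refl
    ; sym   = λ F≈G → pointwise λ x → sym (at F≈G x)
    ; trans = λ F≈G G≈H → pointwise λ x → trans (at F≈G x) (at G≈H x) }

  ≈ᴱ-setoid : Setoid (c ⊔ ℓ) (c ⊔ ℓ)
  ≈ᴱ-setoid = record { isEquivalence = ≈ᴱ-isEquivalence }

  +ᴱ-cong : ∀ {F F′ G G′} → F ≈ᴱ F′ → G ≈ᴱ G′ → F +ᴱ G ≈ᴱ F′ +ᴱ G′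
  +ᴱ-cong F≈F′ G≈G′ = pointwise λ x → ∙-cong (at F≈F′ x) (at G≈G′ x)

  *ᴱ-congˡ : ∀ F {G H} → G ≈ᴱ H → F *ᴱ G ≈ᴱ F *ᴱ H
  *ᴱ-congˡ F G≈H = pointwise λ x → ⟦⟧-cong F (at G≈H x)

  *ᴱ-commutes-+ᴱ : ∀ F G H → F *ᴱ G ≈ᴱ G *ᴱ F → F *ᴱ H ≈ᴱ H *ᴱ F →
                   F *ᴱ (G +ᴱ H) ≈ᴱ (G +ᴱ H) *ᴱ F
  *ᴱ-commutes-+ᴱ F G H FG≈GF FH≈HF =
    pointwise λ x → trans (homo F _ _) (∙-cong (at FG≈GF x) (at FH≈HF x))

  semiring : Semiring (c ⊔ ℓ) (c ⊔ ℓ)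
  semiring = record
    { Carrier = Endomorphism
    ; _≈_ = _≈ᴱ_
    ; _+_ = _+ᴱ_
    ; _*_ = _*ᴱ_
    ; 0# = 0ᴱ
    ; 1# = 1ᴱ
    ; isSemiring = record
      { isSemiringWithoutAnnihilatingZero = isSemiringWithoutAnnihilatingZero* record
        { +-isCommutativeMonoid = record
          { isMonoid = record
            { isSemigroup = record
              { isMagma = record
                { isEquivalence = ≈ᴱ-isEquivalence
                ; ∙-cong = +ᴱ-cong }
              ; assoc = λ F G H → pointwise λ x → assoc _ _ _ }
            ; identity = (λ F → pointwise λ x → identityˡ _) , (λ F → pointwise λ x → identityʳ _) }
          ; comm = λ F G → pointwise λ x → comm _ _ }
        ; *-isMonoid = record
          { isSemigroup = record
            { isMagma = record
              { isEquivalence = ≈ᴱ-isEquivalence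
              ; ∙-cong = λ {F} {F′} {G} {G′} F≈F′ G≈G′ → pointwise λ x →
                  trans (⟦⟧-cong F (at G≈G′ x)) (at F≈F′ (⟦ G′ ⟧ x)) }
            ; assoc = λ F G H → pointwise λ x → refl }
          ; identity = (λ F → pointwise λ x → refl) , (λ F → pointwise λ x → refl) }
        ; distrib = (λ F G H → pointwise λ x → homo F _ _) , (λ F G H → pointwise λ x → refl) }
      ; zero = (λ F → pointwise λ x → refl) , (λ F → pointwise λ x → ε-homo F) } }

module ScaledShifts {p : ℕ} (p-prime : Prime p) where

  open import Algebra.Bundles using (CommutativeRing; Semiring)
  import Algebra.Construct.Pointwise as Pointwise
  open import Data.Integer.Base using (+_; _+_; _*_; _^_; 1ℤ)
  import Data.Integer.Properties as ℤ
  open import Data.Integer.Tactic.RingSolver using (solve-∀)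
  open import Data.Nat.Base as ℕ using (suc)
  open import Relation.Binary.PropositionalEquality as ≡ using (_≡_)
  import Relation.Binary.Reasoning.Setoid as SetoidReasoning
  open import Relation.Binary.Structures using (IsEquivalence)

  open Modulo p public
  open CommutativeRing commutativeRing using (+-commutativeMonoid)
  open EndomorphismSemiring (Pointwise.commutativeMonoid ℤ +-commutativeMonoid) public
  open import Algebra.Definitions.RawSemiring (Semiring.rawSemiring semiring) public
    using () renaming (_^_ to _^ᴱ_; _×_ to _×ᴱ_)
  open FermatsLittleTheorem p-prime using (fermat)
  open IsEquivalence ≈ᴱ-isEquivalence public using () renaming (refl to ≈ᴱ-refl; trans to ≈ᴱ-trans)

  scaledShift : ℤ → ℤ → Endomorphism
  scaledShift α s = endomorphism (λ g k → α * g (k + s))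
    (λ g≈h k → *-cong (≈-refl {α}) (g≈h (k + s)))
    (λ g h k → ≈-reflexive (ℤ.*-distribˡ-+ α (g (k + s)) (h (k + s))))
    (λ k → ≈-reflexive (ℤ.*-zeroʳ α))

  scaledShift-cong : ∀ {α β s t} → α ≈ β → s ≡ t → scaledShift α s ≈ᴱ scaledShift β t
  scaledShift-cong {s = s} α≈β ≡.refl = pointwise λ g k → *-cong α≈β (≈-refl {g (k + s)})

  scaledShift-* : ∀ α s β t → scaledShift α s *ᴱ scaledShift β t ≈ᴱ scaledShift (α * β) (s + t)
  scaledShift-* α s β t = pointwise λ g k →
    ≈-reflexive (≡.trans (≡.sym (ℤ.*-assoc α β _)) (≡.cong (λ i → α * β * g i) (ℤ.+-assoc k s t)))

  scaledShift-^ : ∀ α s n → scaledShift α s ^ᴱ n ≈ᴱ scaledShift (α ^ n) (+ n * s)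
  scaledShift-^ α s ℕ.zero  = pointwise λ g k →
    ≈-reflexive (≡.trans (≡.sym (ℤ.*-identityˡ (g k))) (≡.cong (λ i → 1ℤ * g i) (≡.sym (ℤ.+-identityʳ k))))
  scaledShift-^ α s (suc n) = begin
    scaledShift α s *ᴱ scaledShift α s ^ᴱ n           ≈⟨ *ᴱ-congˡ (scaledShift α s) (scaledShift-^ α s n) ⟩
    scaledShift α s *ᴱ scaledShift (α ^ n) (+ n * s)  ≈⟨ scaledShift-* α s (α ^ n) (+ n * s) ⟩
    scaledShift (α * α ^ n) (s + + n * s)             ≈⟨ scaledShift-cong (≈-refl {α * α ^ n}) (s+ms≡[1+m]s (+ n) s) ⟩
    scaledShift (α ^ suc n) (+ suc n * s)             ∎
    where
    open SetoidReasoning ≈ᴱ-setoid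
    s+ms≡[1+m]s : ∀ m s → s + m * s ≡ (1ℤ + m) * s
    s+ms≡[1+m]s = solve-∀

  scaledShifts-commute : ∀ α s β t → scaledShift α s *ᴱ scaledShift β t ≈ᴱ scaledShift β t *ᴱ scaledShift α s
  scaledShifts-commute α s β t = begin
    scaledShift α s *ᴱ scaledShift β t  ≈⟨ scaledShift-* α s β t ⟩
    scaledShift (α * β) (s + t)         ≈⟨ scaledShift-cong (≈-reflexive (ℤ.*-comm α β)) (ℤ.+-comm s t) ⟩
    scaledShift (β * α) (t + s)         ≈⟨ scaledShift-* β t α s ⟨
    scaledShift β t *ᴱ scaledShift α s  ∎
    where open SetoidReasoning ≈ᴱ-setoid

  scaledShift-frobenius : ∀ α s → scaledShift α s ^ᴱ p ≈ᴱ scaledShift α (+ p * s)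
  scaledShift-frobenius α s = ≈ᴱ-trans (scaledShift-^ α s p) (scaledShift-cong (fermat α) ≡.refl)

  characteristic : p ×ᴱ 1ᴱ ≈ᴱ 0ᴱ
  characteristic = pointwise λ g k → ≈-trans (≈-reflexive (×1ᴱ≡ p g k)) (n*≈0 (g k))
    where
    ×1ᴱ≡ : ∀ m g k → ⟦ m ×ᴱ 1ᴱ ⟧ g k ≡ + m * g k
    ×1ᴱ≡ ℕ.zero  g k = ≡.refl
    ×1ᴱ≡ (suc m) g k = ≡.trans (≡.cong (_+_ (g k)) (×1ᴱ≡ m g k)) (x+mx≡[1+m]x (g k) (+ m))
      where
      x+mx≡[1+m]x : ∀ x m → x + m * x ≡ (1ℤ + m) * x
      x+mx≡[1+m]x = solve-∀

module LucasCongruence {p : ℕ} (p-prime : Prime p) (αm α0 α1 : ℤ) where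

  open import Algebra.Bundles using (CommutativeRing)
  open import Data.Integer.Base using (+_; -[1+_]; ∣_∣; _+_; _*_; _-_; -_; 0ℤ; 1ℤ; -1ℤ)
  import Data.Integer.Properties as ℤ
  open import Data.Integer.Divisibility.Signed using (_∣_; divides; ∣⇒∣ᵤ; ∣m+n∣m⇒∣n; ∣m⇒∣m*n; ∣-refl)
  open import Data.Integer.Tactic.RingSolver using (solve-∀)
  open import Data.Nat.Base as ℕ using (suc)
  open import Data.Nat.Divisibility using (∣⇒≤)
  open import Data.Nat.Primality using (¬prime[0])
  import Data.Nat.Properties as ℕ
  open import Data.Sum using ([_,_]′)
  open import Relation.Binary.PropositionalEquality as ≡ using (_≡_; _≢_)
  import Relation.Binary.Reasoning.Setoid as SetoidReasoning
  open import Relation.Nullary using (yes; no; contradiction)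

  open ScaledShifts p-prime
  open CommutativeRing commutativeRing using (setoid)

  -- ⟦ mulP q ⟧ g is the coefficient sequence of P(x^q)·G(x) when g is that of G(x).
  mulP : ℤ → Endomorphism
  mulP q = scaledShift αm (q * 1ℤ) +ᴱ (scaledShift α0 (q * 0ℤ) +ᴱ scaledShift α1 (q * -1ℤ))

  mulP-frobenius : mulP 1ℤ ^ᴱ p ≈ᴱ mulP (+ p)
  mulP-frobenius = begin
    (X +ᴱ (A +ᴱ B)) ^ᴱ p
      ≈⟨ dream X (A +ᴱ B) (*ᴱ-commutes-+ᴱ X A B (scaledShifts-commute αm 1ℤ α0 0ℤ) (scaledShifts-commute αm 1ℤ α1 -1ℤ)) ⟩
    X ^ᴱ p +ᴱ (A +ᴱ B) ^ᴱ p
      ≈⟨ +ᴱ-cong (≈ᴱ-refl {X ^ᴱ p}) (dream A B (scaledShifts-commute α0 0ℤ α1 -1ℤ)) ⟩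
    X ^ᴱ p +ᴱ (A ^ᴱ p +ᴱ B ^ᴱ p)
      ≈⟨ +ᴱ-cong (scaledShift-frobenius αm 1ℤ) (+ᴱ-cong (scaledShift-frobenius α0 0ℤ) (scaledShift-frobenius α1 -1ℤ)) ⟩
    mulP (+ p)                 ∎
    where
    X = scaledShift αm 1ℤ
    A = scaledShift α0 0ℤ
    B = scaledShift α1 -1ℤ
    dream : ∀ F G → F *ᴱ G ≈ᴱ G *ᴱ F → (F +ᴱ G) ^ᴱ p ≈ᴱ F ^ᴱ p +ᴱ G ^ᴱ p
    dream F G = FreshmansDream.freshmansDream semiring {F} {G} p-prime characteristic
    open SetoidReasoning ≈ᴱ-setoid

  coeff : ℕ → ℤ → ℤ
  coeff = coeffPow αm α0 α1

  coeff-suc : ∀ n k → coeff (suc n) k ≈ ⟦ mulP 1ℤ ⟧ (coeff n) k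
  coeff-suc n k = ≈-reflexive (≡.trans (ℤ.+-assoc (αm * coeff n (k + 1ℤ)) (α0 * coeff n k) (α1 * coeff n (k - 1ℤ)))
    (≡.cong (λ i → αm * coeff n (k + 1ℤ) + (α0 * coeff n i + α1 * coeff n (k - 1ℤ))) (≡.sym (ℤ.+-identityʳ k))))

  coeff-+ : ∀ m n k → coeff (m ℕ.+ n) k ≈ ⟦ mulP 1ℤ ^ᴱ m ⟧ (coeff n) k
  coeff-+ ℕ.zero  n k = ≈-refl
  coeff-+ (suc m) n k = ≈-trans (coeff-suc (m ℕ.+ n) k)
    (⟦⟧-cong (mulP 1ℤ) {coeff (m ℕ.+ n)} {⟦ mulP 1ℤ ^ᴱ m ⟧ (coeff n)} (coeff-+ m n) k)

  ≈-at : ∀ (g : ℤ → ℤ) {i j} → i ≡ j → g i ≈ g j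
  ≈-at g i≡j = ≈-reflexive (≡.cong g i≡j)

  -- g is, modulo p, the coefficient sequence of H(x^p) when h is that of H(x).
  record Dilation (h g : ℤ → ℤ) : Set where
    field
      on-multiples  : ∀ j → g (+ p * j) ≈ h j
      off-multiples : ∀ j s → 0 ℕ.< s → s ℕ.< p → g (+ p * j + + s) ≈ 0ℤ

  open Dilation

  dilation-cong : ∀ {h h′ g g′} → (∀ k → h k ≈ h′ k) → (∀ k → g k ≈ g′ k) →
                  Dilation h g → Dilation h′ g′
  dilation-cong h≈h′ g≈g′ d = record
    { on-multiples  = λ j → ≈-trans (≈-sym (g≈g′ _)) (≈-trans (on-multiples d j) (h≈h′ j))
    ; off-multiples = λ j s 0<s s<p → ≈-trans (≈-sym (g≈g′ _)) (off-multiples d j s 0<s s<p) }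

  +-dilation : ∀ {h g h′ g′} → Dilation h g → Dilation h′ g′ →
               Dilation (λ k → h k + h′ k) (λ k → g k + g′ k)
  +-dilation d d′ = record
    { on-multiples  = λ j → +-cong (on-multiples d j) (on-multiples d′ j)
    ; off-multiples = λ j s 0<s s<p → +-cong (off-multiples d j s 0<s s<p) (off-multiples d′ j s 0<s s<p) }

  scaledShift-dilation : ∀ {h g} → Dilation h g → ∀ α e →
                         Dilation (⟦ scaledShift α e ⟧ h) (⟦ scaledShift α (+ p * e) ⟧ g)
  scaledShift-dilation {h} {g} d α e = record
    { on-multiples  = λ j → *-cong (≈-refl {α})
        (≈-trans (≈-at g (≡.sym (ℤ.*-distribˡ-+ (+ p) j e))) (on-multiples d (j + e)))
    ; off-multiples = λ j s 0<s s<p → ≈-trans (*-cong (≈-refl {α})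
        (≈-trans (≈-at g (reassociate (+ p) j (+ s) e)) (off-multiples d (j + e) s 0<s s<p)))
        (≈-reflexive (ℤ.*-zeroʳ α)) }
    where
    reassociate : ∀ p j s e → p * j + s + p * e ≡ p * (j + e) + s
    reassociate = solve-∀

  mulP-dilation : ∀ {h g} → Dilation h g → Dilation (⟦ mulP 1ℤ ⟧ h) (⟦ mulP (+ p) ⟧ g)
  mulP-dilation d = +-dilation (scaledShift-dilation d αm 1ℤ)
    (+-dilation (scaledShift-dilation d α0 0ℤ) (scaledShift-dilation d α1 -1ℤ))

  coeff₀-off-origin : ∀ {k} → k ≢ 0ℤ → coeff 0 k ≡ 0ℤ
  coeff₀-off-origin {k} k≢0 with k ℤ.≟ 0ℤ
  ... | yes k≡0 = contradiction k≡0 k≢0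
  ... | no  _   = ≡.refl

  off-multiple≢0 : ∀ j {s} → 0 ℕ.< s → s ℕ.< p → + p * j + + s ≢ 0ℤ
  off-multiple≢0 j {s} 0<s s<p pj+s≡0 = ℕ.<⇒≱ s<p (∣⇒≤ {{ℕ.>-nonZero 0<s}} (∣⇒∣ᵤ p∣s))
    where
    p∣s : + p ∣ + s
    p∣s = ∣m+n∣m⇒∣n (≡.subst (+ p ∣_) (≡.sym pj+s≡0) (divides 0ℤ ≡.refl)) (∣m⇒∣m*n j ∣-refl)

  p≢0 : + p ≢ 0ℤ
  p≢0 p≡0 = ¬prime[0] (≡.subst Prime (ℤ.+-injective p≡0) p-prime)

  coeff₀-dilation : Dilation (coeff 0) (coeff 0)
  coeff₀-dilation = record
    { on-multiples  = on-multiples₀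
    ; off-multiples = λ j s 0<s s<p → ≈-reflexive (coeff₀-off-origin (off-multiple≢0 j 0<s s<p)) }
    where
    on-multiples₀ : ∀ j → coeff 0 (+ p * j) ≈ coeff 0 j
    on-multiples₀ j with j ℤ.≟ 0ℤ
    ... | yes ≡.refl = ≈-reflexive (≡.cong (coeff 0) (ℤ.*-zeroʳ (+ p)))
    ... | no  j≢0    = ≈-reflexive (coeff₀-off-origin pj≢0)
      where
      pj≢0 : + p * j ≢ 0ℤ
      pj≢0 pj≡0 = [ p≢0 , j≢0 ]′ (ℤ.i*j≡0⇒i≡0∨j≡0 (+ p) pj≡0)

  coeff-dilation : ∀ m → Dilation (coeff m) (coeff (m ℕ.* p))
  coeff-dilation ℕ.zero    = coeff₀-dilation
  coeff-dilation (suc m) = dilation-cong (λ k → ≈-sym (coeff-suc m k)) (λ k → ≈-sym (coeff[p+mp]≈ k))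
    (mulP-dilation {coeff m} {coeff (m ℕ.* p)} (coeff-dilation m))
    where
    coeff[p+mp]≈ : ∀ k → coeff (p ℕ.+ m ℕ.* p) k ≈ ⟦ mulP (+ p) ⟧ (coeff (m ℕ.* p)) k
    coeff[p+mp]≈ k = ≈-trans (coeff-+ p (m ℕ.* p) k) (at mulP-frobenius (coeff (m ℕ.* p)) k)

  dilation-near-origin : ∀ {h g} → Dilation h g → ∀ k → ∣ k ∣ ℕ.< p → g k ≈ coeff 0 k * h 0ℤ
  dilation-near-origin {h} {g} d (+ ℕ.zero) _ =
    ≈-trans (≈-at g (≡.sym (ℤ.*-zeroʳ (+ p))))
      (≈-trans (on-multiples d 0ℤ) (≈-reflexive (≡.sym (ℤ.*-identityˡ (h 0ℤ)))))
  dilation-near-origin {h} {g} d (+ suc i) 1+i<p =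
    ≈-trans (≈-at g (≡.cong (_+ + suc i) (≡.sym (ℤ.*-zeroʳ (+ p))))) (off-multiples d 0ℤ (suc i) ℕ.z<s 1+i<p)
  dilation-near-origin {h} {g} d -[1+ i ] 1+i<p =
    ≈-trans (≈-at g (≡.sym -p+t≡))
      (off-multiples d -1ℤ t (ℕ.m<n⇒0<n∸m 1+i<p) (ℕ.∸-monoʳ-< ℕ.z<s (ℕ.<⇒≤ 1+i<p)))
    where
    t = p ℕ.∸ suc i
    -p+t≡ : + p * -1ℤ + + t ≡ -[1+ i ]
    -p+t≡ = begin
      + p * -1ℤ + + t                 ≡⟨ ≡.cong (λ n → + n * -1ℤ + + t) (ℕ.m+[n∸m]≡n (ℕ.<⇒≤ 1+i<p)) ⟨
      + (suc i ℕ.+ t) * -1ℤ + + t     ≡⟨ ≡.cong (λ n → n * -1ℤ + + t) (ℤ.pos-+ (suc i) t) ⟩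
      (+ suc i + + t) * -1ℤ + + t     ≡⟨ [a+b]*-1+b≡-a (+ suc i) (+ t) ⟩
      -[1+ i ]                        ∎
      where
      open ≡.≡-Reasoning
      [a+b]*-1+b≡-a : ∀ a b → (a + b) * -1ℤ + b ≡ - a
      [a+b]*-1+b≡-a = solve-∀

  mulP^r-near-origin : ∀ {h g} → Dilation h g → ∀ r k → ∣ k ∣ ℕ.+ r ℕ.< p →
                       ⟦ mulP 1ℤ ^ᴱ r ⟧ g k ≈ coeff r k * h 0ℤ
  mulP^r-near-origin d ℕ.zero k k<p =
    dilation-near-origin d k (≡.subst (ℕ._< p) (ℕ.+-identityʳ ∣ k ∣) k<p)
  mulP^r-near-origin {h} {g} d (suc r) k k+1+r<p = begin
    αm * G (k + 1ℤ) + (α0 * G (k + 0ℤ) + α1 * G (k + -1ℤ))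
      ≈⟨ +-cong (*-cong (≈-refl {αm}) (near 1ℤ ℕ.≤-refl))
                (+-cong (*-cong (≈-refl {α0}) (near 0ℤ ℕ.z≤n)) (*-cong (≈-refl {α1}) (near -1ℤ ℕ.≤-refl))) ⟩
    αm * (coeff r (k + 1ℤ) * h 0ℤ) + (α0 * (coeff r (k + 0ℤ) * h 0ℤ) + α1 * (coeff r (k + -1ℤ) * h 0ℤ))
      ≈⟨ ≈-reflexive (factor-out αm α0 α1 (coeff r (k + 1ℤ)) (coeff r (k + 0ℤ)) (coeff r (k + -1ℤ)) (h 0ℤ)) ⟩
    ⟦ mulP 1ℤ ⟧ (coeff r) k * h 0ℤ
      ≈⟨ *-cong (≈-sym (coeff-suc r k)) (≈-refl {h 0ℤ}) ⟩
    coeff (suc r) k * h 0ℤ ∎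
    where
    open SetoidReasoning setoid
    G = ⟦ mulP 1ℤ ^ᴱ r ⟧ g
    near : ∀ e → ∣ e ∣ ℕ.≤ 1 → G (k + e) ≈ coeff r (k + e) * h 0ℤ
    near e ∣e∣≤1 = mulP^r-near-origin d r (k + e) (ℕ.≤-<-trans ∣k+e∣+r≤∣k∣+1+r k+1+r<p)
      where
      ∣k+e∣+r≤∣k∣+1+r : ∣ k + e ∣ ℕ.+ r ℕ.≤ ∣ k ∣ ℕ.+ suc r
      ∣k+e∣+r≤∣k∣+1+r =
        ℕ.≤-trans (ℕ.+-monoˡ-≤ r (ℕ.≤-trans (ℤ.∣i+j∣≤∣i∣+∣j∣ k e) (ℕ.+-monoʳ-≤ ∣ k ∣ ∣e∣≤1)))
                  (ℕ.≤-reflexive (ℕ.+-assoc ∣ k ∣ 1 r))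
    factor-out : ∀ a b d x y z w → a * (x * w) + (b * (y * w) + d * (z * w)) ≡ (a * x + (b * y + d * z)) * w
    factor-out = solve-∀

  lucas : ∀ m r → r ℕ.< p → coeff (r ℕ.+ m ℕ.* p) 0ℤ ≈ coeff r 0ℤ * coeff m 0ℤ
  lucas m r r<p = ≈-trans (coeff-+ r (m ℕ.* p) 0ℤ) (mulP^r-near-origin (coeff-dilation m) r 0ℤ r<p)

module DivisibleTerms {p : ℕ} (p-prime : Prime p) (αm α0 α1 : ℤ) where

  open import Data.Integer.Base using (+_)
  open import Data.Integer.Divisibility.Signed using (_∣_; ∣n⇒∣m*n; ∣m⇒∣m*n)
  open import Data.Nat.Base as ℕ using (zero; suc; _+_; _*_; _^_; _%_; _/_; _<_)
  import Data.Nat.Properties as ℕ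
  open import Data.Nat.DivMod using (m≡m%n+[m/n]*n; m%n<n; m/n<m; m<n*o⇒m/o<n)
  open import Data.Nat.Induction using (<-rec)
  open import Data.Nat.Tactic.RingSolver using (solve-∀)
  open import Data.Product using (Σ; _×_; _,_)
  open import Data.Sum using (_⊎_; [_,_]′)
  open import Relation.Binary.PropositionalEquality using (_≡_; subst; sym; trans; cong)
  open import Relation.Nullary using (yes; no)
  open Modulo p using (≈-trans; ≈-sym; ∣⇒≈0; ≈0⇒∣)
  open LucasCongruence p-prime αm α0 α1 using (lucas)
  open PrimeDivisibility using (euclidsLemmaℤ)

  open Prime p-prime using (nontrivial)
  instance _ = ℕ.nonTrivial⇒nonZero p

  Divisible : ℕ → Set
  Divisible n = + p ∣ ctPow αm α0 α1 n

  divisible-lastDigit : ∀ m {r} → r < p → Divisible r → Divisible (r + m * p)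
  divisible-lastDigit m {r} r<p p∣ar =
    ≈0⇒∣ (≈-trans (lucas m r r<p) (∣⇒≈0 (∣m⇒∣m*n (ctPow αm α0 α1 m) p∣ar)))

  divisible-prefix₁ : ∀ m {r} → r < p → Divisible m → Divisible (r + m * p)
  divisible-prefix₁ m {r} r<p p∣am =
    ≈0⇒∣ (≈-trans (lucas m r r<p) (∣⇒≈0 (∣n⇒∣m*n (ctPow αm α0 α1 r) p∣am)))

  divisible-split : ∀ m {r} → r < p → Divisible (r + m * p) → Divisible r ⊎ Divisible m
  divisible-split m {r} r<p p∣a = euclidsLemmaℤ p-prime (ctPow αm α0 α1 r) (ctPow αm α0 α1 m)
    (≈0⇒∣ (≈-trans (≈-sym (lucas m r r<p)) (∣⇒≈0 p∣a)))

  divisible-digit-exists : ∀ n → Divisible n → Σ ℕ λ d → d < p × Divisible d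
  divisible-digit-exists = <-rec _ step
    where
    step : ∀ n → (∀ {m} → m < n → Divisible m → Σ ℕ λ d → d < p × Divisible d) →
           Divisible n → Σ ℕ λ d → d < p × Divisible d
    step n rec p∣an with n ℕ.<? p
    ... | yes n<p = n , n<p , p∣an
    ... | no  n≮p = [ (λ p∣a[n%p] → n % p , m%n<n n p , p∣a[n%p]) , rec n/p<n ]′
                      (divisible-split (n / p) (m%n<n n p) (subst Divisible (m≡m%n+[m/n]*n n p) p∣an))
      where
      n/p<n : n / p < n
      n/p<n = m/n<m n p {{ℕ.>-nonZero (ℕ.<-≤-trans (ℕ.>-nonZero⁻¹ p) (ℕ.≮⇒≥ n≮p))}} (ℕ.nonTrivial⇒n>1 p)

  divisible-prefix : ∀ L q {t} → t < p ^ L → Divisible q → Divisible (t + q * p ^ L)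
  divisible-prefix zero    q {zero}  _          p∣aq = subst Divisible (sym (ℕ.*-identityʳ q)) p∣aq
  divisible-prefix zero    q {suc _} (ℕ.s≤s ()) _
  divisible-prefix (suc L) q {t} t<p^[1+L] p∣aq =
    subst Divisible t%p+[t/p+qp^L]p≡t+qp^[1+L]
      (divisible-prefix₁ (t / p + q * p ^ L) (m%n<n t p) (divisible-prefix L q t/p<p^L p∣aq))
    where
    t/p<p^L : t / p < p ^ L
    t/p<p^L = m<n*o⇒m/o<n (subst (t <_) (ℕ.*-comm p (p ^ L)) t<p^[1+L])
    regroup : ∀ r d P Q q → r + (d + q * Q) * P ≡ r + d * P + q * (P * Q)
    regroup = solve-∀
    t%p+[t/p+qp^L]p≡t+qp^[1+L] : t % p + (t / p + q * p ^ L) * p ≡ t + q * p ^ suc L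
    t%p+[t/p+qp^L]p≡t+qp^[1+L] =
      trans (regroup (t % p) (t / p) p (p ^ L) q) (cong (_+ q * p ^ suc L) (sym (m≡m%n+[m/n]*n t p)))

module Counting where

  open import Data.Bool.Base using (Bool; true; false; if_then_else_; not; T)
  open import Data.Nat.Base using (zero; suc; _+_; _∸_; _≤_; _<_; z≤n; s≤s)
  open import Data.Nat.Properties
  open import Relation.Binary.PropositionalEquality using (_≡_; refl; sym; trans; cong; cong₂; module ≡-Reasoning)
  open import Data.Sum using (inj₁; inj₂)

  indicator : Bool → ℕ
  indicator b = if b then 1 else 0

  indicator≤1 : ∀ b → indicator b ≤ 1
  indicator≤1 true  = ≤-refl
  indicator≤1 false = z≤n

  indicator-not : ∀ {b} → T (not b) → indicator b ≡ 0
  indicator-not {false} _ = refl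

  count : (ℕ → Bool) → ℕ → ℕ
  count P zero    = 0
  count P (suc N) = count P N + indicator (P N)

  count≤ : ∀ P N → count P N ≤ N
  count≤ P zero    = z≤n
  count≤ P (suc N) = ≤-trans (+-mono-≤ (count≤ P N) (indicator≤1 (P N))) (≤-reflexive (+-comm N 1))

  count-+ : ∀ P a b → count P (a + b) ≡ count P a + count (λ r → P (a + r)) b
  count-+ P a zero    = trans (cong (count P) (+-identityʳ a)) (sym (+-identityʳ _))
  count-+ P a (suc b) = begin
    count P (a + suc b)                                            ≡⟨ cong (count P) (+-suc a b) ⟩
    count P (a + b) + indicator (P (a + b))                        ≡⟨ cong (_+ indicator (P (a + b))) (count-+ P a b) ⟩
    count P a + count (λ r → P (a + r)) b + indicator (P (a + b))  ≡⟨ +-assoc (count P a) _ _ ⟩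
    count P a + count (λ r → P (a + r)) (suc b)                    ∎
    where open ≡-Reasoning

  count-cong : ∀ {P Q} N → (∀ {r} → r < N → P r ≡ Q r) → count P N ≡ count Q N
  count-cong zero    P≡Q = refl
  count-cong (suc N) P≡Q = cong₂ _+_ (count-cong N (λ r<N → P≡Q (m<n⇒m<1+n r<N))) (cong indicator (P≡Q (n<1+n N)))

  count-mono : ∀ P {M N} → M ≤ N → count P M ≤ count P N
  count-mono P {M} {N} M≤N = begin
    count P M                                   ≤⟨ m≤m+n _ _ ⟩
    count P M + count (λ r → P (M + r)) (N ∸ M) ≡⟨ count-+ P M (N ∸ M) ⟨
    count P (M + (N ∸ M))                       ≡⟨ cong (count P) (m+[n∸m]≡n M≤N) ⟩
    count P N                                   ∎
    where open ≤-Reasoning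

  count-false : ∀ N → count (λ _ → false) N ≡ 0
  count-false zero    = refl
  count-false (suc N) = trans (+-identityʳ _) (count-false N)

  count-true : ∀ N → count (λ _ → true) N ≡ N
  count-true zero    = refl
  count-true (suc N) = trans (cong (_+ 1) (count-true N)) (+-comm N 1)

  count< : ∀ P {N r} → r < N → T (not (P r)) → count P N < N
  count< P {suc N} {r} r<1+N ¬Pr with m<1+n⇒m<n∨m≡n r<1+N
  ... | inj₁ r<N  = s≤s (≤-trans (+-monoʳ-≤ (count P N) (indicator≤1 (P N)))
                               (≤-trans (≤-reflexive (+-comm _ 1)) (count< P r<N ¬Pr)))
  ... | inj₂ refl = s≤s (≤-trans (≤-reflexive (trans (cong (count P N +_) (indicator-not ¬Pr)) (+-identityʳ _)))
                               (count≤ P N))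

module PowerInequalities where

  open import Data.Nat.Base using (zero; suc; _+_; _*_; _^_; _≤_; _<_; z≤n; s≤s; z<s; >-nonZero)
  open import Data.Nat.Properties
  open import Data.Nat.Tactic.RingSolver using (solve-∀)
  open import Relation.Binary.PropositionalEquality using (_≡_; sym; trans; cong)

  bernoulli : ∀ u n → u ^ n * (u + n) ≤ u * suc u ^ n
  bernoulli u zero    = ≤-reflexive (trans (+-identityʳ (u + 0)) (trans (+-identityʳ u) (sym (*-identityʳ u))))
  bernoulli u (suc n) = begin
    u ^ suc n * (u + suc n)                ≡⟨ expand u (u ^ n) n ⟩
    u * (u ^ n * (u + n)) + u ^ n * u      ≤⟨ +-monoʳ-≤ (u * (u ^ n * (u + n))) (*-monoʳ-≤ (u ^ n) (m≤m+n u n)) ⟩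
    u * (u ^ n * (u + n)) + u ^ n * (u + n) ≡⟨ collect u (u ^ n * (u + n)) ⟩
    suc u * (u ^ n * (u + n))              ≤⟨ *-monoʳ-≤ (suc u) (bernoulli u n) ⟩
    suc u * (u * suc u ^ n)                ≡⟨ x∙yz≈y∙xz (suc u) u (suc u ^ n) ⟩
    u * suc u ^ suc n                      ∎
    where
    open ≤-Reasoning
    open import Algebra.Properties.CommutativeSemigroup *-commutativeSemigroup using (x∙yz≈y∙xz)
    expand : ∀ u P n → u * P * (u + suc n) ≡ u * (P * (u + n)) + P * u
    expand = solve-∀
    collect : ∀ u X → u * X + X ≡ suc u * X
    collect = solve-∀

  n<m^n : ∀ {m} → 1 < m → ∀ n → n < m ^ n
  n<m^n         1<m zero    = s≤s z≤n
  n<m^n {m} 1<m (suc n) = begin-strict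
    suc n                ≤⟨ n<m^n 1<m n ⟩
    m ^ n                <⟨ m<m+n (m ^ n) (m^n>0 m n) ⟩
    m ^ n + m ^ n        ≡⟨ cong (m ^ n +_) (+-identityʳ (m ^ n)) ⟨
    2 * m ^ n            ≤⟨ *-monoˡ-≤ (m ^ n) 1<m ⟩
    m * m ^ n            ∎
    where
    open ≤-Reasoning
    instance _ = >-nonZero (<-trans z<s 1<m)

  2n*u^[1+2nu]≤B^[1+2nu] : ∀ {u B} → u < B → ∀ n → 2 * n * u ^ suc (2 * n * u) ≤ B ^ suc (2 * n * u)
  2n*u^[1+2nu]≤B^[1+2nu] {zero}        _   n = ≤-trans (≤-reflexive (*-zeroʳ (2 * n))) z≤n
  2n*u^[1+2nu]≤B^[1+2nu] {u@(suc _)} {B} u<B n = *-cancelˡ-≤ u (begin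
    u * (2 * n * u ^ J)   ≡⟨ rearrange u n (u ^ J) ⟩
    u ^ J * (2 * n * u)   ≤⟨ *-monoʳ-≤ (u ^ J) (≤-trans (n≤1+n _) (m≤n+m J u)) ⟩
    u ^ J * (u + J)       ≤⟨ bernoulli u J ⟩
    u * suc u ^ J         ≤⟨ *-monoʳ-≤ u (^-monoˡ-≤ J u<B) ⟩
    u * B ^ J             ∎)
    where
    open ≤-Reasoning
    J = suc (2 * n * u)
    rearrange : ∀ u n P → u * (2 * n * P) ≡ P * (2 * n * u)
    rearrange = solve-∀

module DigitBlocks (B : ℕ) .{{_ : Data.Nat.Base.NonZero B}} (digitSet : ℕ → Data.Bool.Base.Bool) where

  open import Data.Bool.Base using (Bool; true; false; not; _∧_; T)
  open import Data.Bool.Properties using (∧-identityʳ; ∧-zeroʳ; not-involutive)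
  open import Data.Nat.Base using (zero; suc; _+_; _*_; _^_; _%_; _/_; _∸_; _≤_; _<_; z<s)
  open import Data.Nat.Properties
  open import Data.Nat.DivMod
    using ([m+kn]%n≡m%n; m<n⇒m%n≡m; +-distrib-/-∣ʳ; m<n⇒m/n≡0; m*n/n≡m; m≡m%n+[m/n]*n; m%n<n; m≥n⇒m/n>0; m/n*n≤m)
  open import Data.Nat.Divisibility using (n∣m*n)
  open import Data.Nat.Tactic.RingSolver using (solve-∀)
  open import Function.Base using (_∘_)
  open import Relation.Binary.PropositionalEquality using (_≡_; sym; trans; cong; cong₂; subst; module ≡-Reasoning)
  open import Data.Unit using (tt)
  open import Relation.Nullary using (¬_; yes; no; contradiction)
  open Counting
  open PowerInequalities using (2n*u^[1+2nu]≤B^[1+2nu])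

  avoids : ℕ → ℕ → Bool
  avoids zero    n = true
  avoids (suc J) n = not (digitSet (n % B)) ∧ avoids J (n / B)

  u : ℕ
  u = count (not ∘ digitSet) B

  [r+X*B]%B≡r : ∀ {r} X → r < B → (r + X * B) % B ≡ r
  [r+X*B]%B≡r {r} X r<B = trans ([m+kn]%n≡m%n r X B) (m<n⇒m%n≡m r<B)

  [r+X*B]/B≡X : ∀ {r} X → r < B → (r + X * B) / B ≡ X
  [r+X*B]/B≡X {r} X r<B = trans (+-distrib-/-∣ʳ r (n∣m*n X)) (cong₂ _+_ (m<n⇒m/n≡0 r<B) (m*n/n≡m X B))

  count-avoids-block : ∀ J X → count (λ r → avoids (suc J) (X * B + r)) B ≡ u * indicator (avoids J X)
  count-avoids-block J X = trans (count-cong B low-digit) (by-cases (avoids J X))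
    where
    low-digit : ∀ {r} → r < B → avoids (suc J) (X * B + r) ≡ not (digitSet r) ∧ avoids J X
    low-digit {r} r<B rewrite +-comm (X * B) r =
      cong₂ (λ r′ X′ → not (digitSet r′) ∧ avoids J X′) ([r+X*B]%B≡r X r<B) ([r+X*B]/B≡X X r<B)
    by-cases : ∀ b → count (λ r → not (digitSet r) ∧ b) B ≡ u * indicator b
    by-cases true  = trans (count-cong B (λ _ → ∧-identityʳ _)) (sym (*-identityʳ u))
    by-cases false = trans (count-cong B (λ _ → ∧-zeroʳ _)) (trans (count-false B) (sym (*-zeroʳ u)))

  count-avoids-blocks : ∀ J X → count (avoids (suc J)) (X * B) ≡ u * count (avoids J) X
  count-avoids-blocks J zero    = sym (*-zeroʳ u)
  count-avoids-blocks J (suc X) = begin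
    count (avoids (suc J)) (B + X * B)
      ≡⟨ cong (count (avoids (suc J))) (+-comm B (X * B)) ⟩
    count (avoids (suc J)) (X * B + B)
      ≡⟨ count-+ (avoids (suc J)) (X * B) B ⟩
    count (avoids (suc J)) (X * B) + count (λ r → avoids (suc J) (X * B + r)) B
      ≡⟨ cong₂ _+_ (count-avoids-blocks J X) (count-avoids-block J X) ⟩
    u * count (avoids J) X + u * indicator (avoids J X)
      ≡⟨ *-distribˡ-+ u _ _ ⟨
    u * count (avoids J) (suc X)
      ∎
    where open ≡-Reasoning

  count-avoids : ∀ J Q → count (avoids J) (Q * B ^ J) ≡ u ^ J * Q
  count-avoids zero    Q = trans (count-true (Q * 1)) (trans (*-identityʳ Q) (sym (+-identityʳ Q)))
  count-avoids (suc J) Q = begin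
    count (avoids (suc J)) (Q * (B * B ^ J))   ≡⟨ cong (count (avoids (suc J))) (regroup Q B (B ^ J)) ⟩
    count (avoids (suc J)) (Q * B ^ J * B)     ≡⟨ count-avoids-blocks J (Q * B ^ J) ⟩
    u * count (avoids J) (Q * B ^ J)           ≡⟨ cong (u *_) (count-avoids J Q) ⟩
    u * (u ^ J * Q)                            ≡⟨ *-assoc u (u ^ J) Q ⟨
    u ^ suc J * Q                              ∎
    where
    open ≡-Reasoning
    regroup : ∀ Q B P → Q * (B * P) ≡ Q * P * B
    regroup = solve-∀

  digit∈set⇒u<B : ∀ {r} → r < B → T (digitSet r) → u < B
  digit∈set⇒u<B {r} r<B r∈D = count< (not ∘ digitSet) r<B (subst T (sym (not-involutive (digitSet r))) r∈D)

  depth : ℕ → ℕ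
  depth k = suc (2 * k * u)

  avoids-sparse : u < B → ∀ k {N} → B ^ depth k ≤ N → k * count (avoids (depth k)) N ≤ N
  avoids-sparse u<B k {N} M≤N = begin
    k * count (avoids J) N            ≤⟨ *-monoʳ-≤ k (count-mono (avoids J) (<⇒≤ N<[1+Q]*M)) ⟩
    k * count (avoids J) (suc Q * M)  ≡⟨ cong (k *_) (count-avoids J (suc Q)) ⟩
    k * (u ^ J * suc Q)               ≤⟨ *-monoʳ-≤ k (*-monoʳ-≤ (u ^ J) 1+Q≤2Q) ⟩
    k * (u ^ J * (2 * Q))             ≡⟨ rearrange k (u ^ J) Q ⟩
    2 * k * u ^ J * Q                 ≤⟨ *-monoˡ-≤ Q (2n*u^[1+2nu]≤B^[1+2nu] u<B k) ⟩
    M * Q                             ≡⟨ *-comm M Q ⟩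
    Q * M                             ≤⟨ m/n*n≤m N M ⟩
    N                                 ∎
    where
    open ≤-Reasoning
    J = depth k
    M = B ^ J
    instance _ = m^n≢0 B J
    Q = N / M
    N<[1+Q]*M : N < suc Q * M
    N<[1+Q]*M = subst (_< suc Q * M) (sym (m≡m%n+[m/n]*n N M)) (+-monoˡ-< (Q * M) (m%n<n N M))
    1+Q≤2Q : suc Q ≤ 2 * Q
    1+Q≤2Q = begin
      suc Q     ≡⟨ +-comm 1 Q ⟩
      Q + 1     ≤⟨ +-monoʳ-≤ Q (m≥n⇒m/n>0 M≤N) ⟩
      Q + Q     ≡⟨ cong (Q +_) (+-identityʳ Q) ⟨
      2 * Q     ∎
    rearrange : ∀ k U Q → k * (U * (2 * Q)) ≡ 2 * k * U * Q
    rearrange = solve-∀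

  module _ (W : ℕ → Set) {e} (1<e : 1 < e) (e≤B : e ≤ B)
           (from-digit : ∀ {r} m {i} → T (digitSet r) → i < e → W (r + i + m * B))
           (from-quotient : ∀ m {t} → t < B → W m → W (t + m * B)) where

    split : ∀ {n i} → n + i ≡ n % B + i + n / B * B
    split {n} {i} = trans (cong (_+ i) (m≡m%n+[m/n]*n n B)) (swap (n % B) (n / B * B) i)
      where
      swap : ∀ a b c → a + b + c ≡ a + c + b
      swap = solve-∀

    -- If the lowest digit of n is not in digitSet, then n + i lies either in the block of
    -- n / B or, after a carry, in that of n / B + 1; as 1 < e, induction covers both.
    ¬avoids⇒W : ∀ J n → ¬ T (avoids J n) → ∀ {i} → i < e → W (n + i)
    ¬avoids⇒W zero    n ¬avoids = contradiction tt ¬avoids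
    ¬avoids⇒W (suc J) n ¬avoids {i} i<e with digitSet (n % B) in r∈D
    ... | true  = subst W (sym split) (from-digit (n / B) (subst T (sym r∈D) tt) i<e)
    ... | false with n % B + i <? B
    ...   | yes r+i<B = subst W (sym split)
                          (from-quotient (n / B) r+i<B
                            (subst W (+-identityʳ (n / B)) (¬avoids⇒W J (n / B) ¬avoids (<-trans z<s 1<e))))
    ...   | no  r+i≮B = subst W (sym (trans split carry))
                          (from-quotient (n / B + 1) t<B (¬avoids⇒W J (n / B) ¬avoids 1<e))
      where
      t = n % B + i ∸ B
      t<B : t < B
      t<B = m<n+o⇒m∸n<o (n % B + i) B (+-mono-< (m%n<n n B) (<-≤-trans i<e e≤B))
      carry : n % B + i + n / B * B ≡ t + (n / B + 1) * B
      carry = begin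
        n % B + i + n / B * B     ≡⟨ cong (_+ n / B * B) (m+[n∸m]≡n (≮⇒≥ r+i≮B)) ⟨
        B + t + n / B * B         ≡⟨ regroup B t (n / B) ⟩
        t + (n / B + 1) * B       ∎
        where
        open ≡-Reasoning
        regroup : ∀ B t m → B + t + m * B ≡ t + (m + 1) * B
        regroup = solve-∀

module DensityOne where

  open import Data.Bool.Base using (Bool; true; false; T)
  open import Data.Integer.Divisibility.Signed using (_∣_; _∣?_)
  open import Data.Nat.Base using (zero; suc; _+_; _*_; _≤_; z≤n; s≤s)
  open import Data.Nat.Properties
  open import Data.Product using (_,_)
  open import Relation.Nullary using (¬_; yes; no; contradiction)
  open import Relation.Binary.PropositionalEquality using (cong)
  open Counting

  countDiv+count≥ : ∀ d f P → (∀ n → ¬ T (P n) → d ∣ f n) → ∀ N → N ≤ countDiv d f N + count P N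
  countDiv+count≥ d f P P-covers zero    = z≤n
  countDiv+count≥ d f P P-covers (suc N) with d ∣? f N
  ... | yes _     = s≤s (≤-trans (countDiv+count≥ d f P P-covers N) (+-monoʳ-≤ (countDiv d f N) (m≤m+n _ _)))
  ... | no  d∤fN  = exception (P N) (λ ¬PN → d∤fN (P-covers N ¬PN))
    where
    exception : ∀ b → ¬ ¬ T b → suc N ≤ countDiv d f N + (count P N + indicator b)
    exception true  _    = begin
      suc N                                 ≤⟨ s≤s (countDiv+count≥ d f P P-covers N) ⟩
      suc (countDiv d f N + count P N)      ≡⟨ +-suc (countDiv d f N) (count P N) ⟨
      countDiv d f N + suc (count P N)      ≡⟨ cong (countDiv d f N +_) (+-comm 1 (count P N)) ⟩
      countDiv d f N + (count P N + 1)      ∎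
      where open ≤-Reasoning
    exception false ¬¬F = contradiction (λ ()) ¬¬F

  record SparseCover (d : ℤ) (f : ℕ → ℤ) (k : ℕ) : Set where
    field
      exceptional : ℕ → Bool
      covers      : ∀ n → ¬ T (exceptional n) → d ∣ f n
      threshold   : ℕ
      sparse      : ∀ {N} → threshold ≤ N → k * count exceptional N ≤ N

  densityOne : ∀ {d f} → (∀ k → SparseCover d f k) → DivDensityOne d f
  densityOne {d} {f} cover (suc k) _ = threshold , λ N threshold≤N →
    +-cancelʳ-≤ N (k * N) (suc k * countDiv d f N) (begin
      k * N + N                                          ≡⟨ +-comm (k * N) N ⟩
      suc k * N                                          ≤⟨ *-monoʳ-≤ (suc k) (countDiv+count≥ d f exceptional covers N) ⟩
      suc k * (countDiv d f N + count exceptional N)     ≡⟨ *-distribˡ-+ (suc k) (countDiv d f N) (count exceptional N) ⟩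
      suc k * countDiv d f N + suc k * count exceptional N ≤⟨ +-monoʳ-≤ (suc k * countDiv d f N) (sparse threshold≤N) ⟩
      suc k * countDiv d f N + N                         ∎)
    where
    open SparseCover (cover (suc k))
    open ≤-Reasoning

module SumTo where

  open import Data.Nat.Base using (zero; suc; _≤_; z≤n)
  open import Data.Nat.Properties using (n≤1+n; ≤-trans; ≤-refl)
  open import Data.Integer.Divisibility.Signed using (_∣_; ∣m∣n⇒∣m+n)

  ∣-sumTo : ∀ {d} h g → (∀ {i} → i ≤ h → d ∣ g i) → d ∣ sumTo h g
  ∣-sumTo zero    g d∣g = d∣g z≤n
  ∣-sumTo (suc h) g d∣g = ∣m∣n⇒∣m+n (∣-sumTo h g (λ i≤h → d∣g (≤-trans i≤h (n≤1+n h)))) (d∣g ≤-refl)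

module DivisibleCombinations {p : ℕ} (p-prime : Prime p) (αm α0 α1 : ℤ) (h : ℕ) (c : ℕ → ℤ) where

  open import Data.Bool.Base using (Bool; _∧_; T)
  open import Data.Bool.Properties using (T-∧)
  open import Data.Nat.Base
    using (suc; _+_; _*_; _^_; _∸_; _≤_; _<_; _≤ᵇ_; z≤n; s≤s; nonTrivial⇒nonZero; nonTrivial⇒n>1)
  open import Data.Nat.Properties
  open import Data.Nat.Tactic.RingSolver using (solve-∀)
  open import Data.Integer.Base using (+_) renaming (_*_ to _*ℤ_)
  open import Data.Integer.Divisibility.Signed using (∣n⇒∣m*n)
  open import Data.Product using (_,_; proj₁; proj₂)
  open import Function.Bundles using (Equivalence)
  open import Relation.Binary.PropositionalEquality using (_≡_; subst; cong; trans)
  open DivisibleTerms p-prime αm α0 α1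
  open PowerInequalities using (n<m^n)
  open DensityOne using (SparseCover)
  open SumTo using (∣-sumTo)

  open Prime p-prime using (nontrivial)
  instance _ = nonTrivial⇒nonZero p

  b : ℕ → ℤ
  b n = sumTo h (λ i → c i *ℤ ctPow αm α0 α1 (n + i))

  module _ {d : ℕ} (d<p : d < p) (p∣ad : Divisible d) where

    e E B : ℕ
    e = p ^ suc h
    E = p * e
    B = p * E

    instance
      _ = m^n≢0 p (suc h)
      _ = m*n≢0 p e
      _ = m*n≢0 p E

    -- Block digits r = d·E + t with t + e ≤ E: for every i < e, r + i still has
    -- the base-p digit d in position h + 2.
    digitSet : ℕ → Bool
    digitSet r = (d * E ≤ᵇ r) ∧ (r + e ≤ᵇ d * E + E)

    open DigitBlocks B digitSet

    from-digit : ∀ {r} m {i} → T (digitSet r) → i < e → Divisible (r + i + m * B)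
    from-digit {r} m {i} r∈D i<e =
      subst Divisible (trans (regroup t d m p E) (cong (_+ m * B) dE+t≡r+i))
        (divisible-prefix (suc (suc h)) (d + m * p) t<E (divisible-lastDigit m d<p p∣ad))
      where
      dE≤r : d * E ≤ r
      dE≤r = ≤ᵇ⇒≤ (d * E) r (proj₁ (Equivalence.to T-∧ r∈D))
      r+e≤dE+E : r + e ≤ d * E + E
      r+e≤dE+E = ≤ᵇ⇒≤ (r + e) (d * E + E) (proj₂ (Equivalence.to T-∧ r∈D))
      t = r + i ∸ d * E
      dE+t≡r+i : d * E + t ≡ r + i
      dE+t≡r+i = m+[n∸m]≡n (≤-trans dE≤r (m≤m+n r i))
      t<E : t < E
      t<E = m<n+o⇒m∸n<o (r + i) (d * E) (begin-strict
        r + i       <⟨ +-monoʳ-< r i<e ⟩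
        r + e       ≤⟨ r+e≤dE+E ⟩
        d * E + E   ∎)
        where open ≤-Reasoning
      regroup : ∀ t d m p E → t + (d + m * p) * E ≡ d * E + t + m * (p * E)
      regroup = solve-∀

    h<e : h < e
    h<e = <-trans (n<1+n h) (n<m^n (nonTrivial⇒n>1 p) (suc h))

    1<e : 1 < e
    1<e = ≤-<-trans (s≤s z≤n) (n<m^n (nonTrivial⇒n>1 p) (suc h))

    e≤B : e ≤ B
    e≤B = ≤-trans (m≤n*m e p) (m≤n*m E p)

    dE∈D : T (digitSet (d * E))
    dE∈D = Equivalence.from T-∧
      (≤⇒≤ᵇ (≤-refl {d * E}) , ≤⇒≤ᵇ {d * E + e} {d * E + E} (+-monoʳ-≤ (d * E) (m≤n*m e p)))

    u<B : u < B
    u<B = digit∈set⇒u<B (*-monoˡ-< E d<p) dE∈D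

    cover : ∀ k → SparseCover (+ p) b k
    cover k = record
      { exceptional = avoids (depth k)
      ; covers      = λ n ¬avoids → ∣-sumTo h _ λ {i} i≤h → ∣n⇒∣m*n (c i)
          (¬avoids⇒W Divisible 1<e e≤B from-digit (divisible-prefix (suc (suc (suc h))))
                     (depth k) n ¬avoids (≤-<-trans i≤h h<e))
      ; threshold   = B ^ depth k
      ; sparse      = avoids-sparse u<B k }

open DivisibleTerms using (divisible-digit-exists)
open DensityOne using (densityOne)
open DivisibleCombinations using (cover)
open import Data.Nat using (ℕ) renaming (_+_ to _+ℕ_)
open import Data.Nat.Primality using (Prime)
open import Data.Integer using (ℤ; +_) renaming (_*_ to _*ℤ_)
open import Data.Integer.Divisibility.Signed using (_∣_)
open import Data.Product using (Σ; _,_)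

proposition3p3 : (p : ℕ) → Prime p → (αm α0 α1 : ℤ) →
    Σ ℕ (λ n → (+ p) ∣ ctPow αm α0 α1 n) →
    (h : ℕ) → (c : ℕ → ℤ) →
    DivDensityOne (+ p) (λ n → sumTo h (λ i → c i *ℤ ctPow αm α0 α1 (n +ℕ i)))
proposition3p3 p p-prime αm α0 α1 (n , p∣an) h c with divisible-digit-exists p-prime αm α0 α1 n p∣an
... | d , d<p , p∣ad = densityOne (cover p-prime αm α0 α1 h c d<p p∣ad)
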